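{- Let $\Delta$ be a $(d-1)$-dimensional balanced simplicial complex with vertex partition $V(\Delta)=V_1\sqcup\dots\sqcup V_d$. Let $n:=|V|$ and $n_i:=|V_i|$. Then $$h_2(\Delta)\leq\binom{n-d+1}{2}-\sum_{i=1}^{d}\binom{n_i}{2}.$$
   Context: A $(d-1)$-dimensional simplicial complex is balanced if its vertex set has a partition $V_1\sqcup\dots\sqcup V_d$ (color classes) such that every face meets each $V_i$ in at most one vertex. The $h$-vector of a $(d-1)$-dimensional complex is $h_j(\Delta)=\sum_{i=0}^{j}(-1)^{j-i}\binom{d-i}{d-j}f_{i-1}(\Delta)$, where $f_{k}(\Delta)$ is the number of $k$-dimensional faces ($f_{ -1}=1$); in particular $h_2(\Delta)=\binom{d}{2}-(d-1)f_0(\Delta)+f_1(\Delta)$. -}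

module Defs where

open import Level using (0ℓ)
open import Data.Nat using (ℕ; zero; suc; _+_; _∸_; _≤_)
open import Data.Nat.Combinatorics using (_C_)
open import Data.Fin using (Fin)
import Data.Fin as Fin
open import Data.Fin.Subset using (Subset; _∈_; _⊆_; ∣_∣; ⁅_⁆; ⊥)
open import Data.Vec using (_∷_; [])
open import Data.List using (List; []; _∷_; _++_; map; filter; length; allFin)
open import Data.Bool using (true; false)
open import Data.Product using (_×_; ∃)
open import Relation.Unary using (Pred; Decidable)
open import Relation.Nullary.Decidable using (_×-dec_)
open import Relation.Binary.PropositionalEquality using (_≡_)
import Data.Nat as ℕ
open import Data.Integer as ℤ using (ℤ; +_)

allSubsets : (m : ℕ) → List (Subset m)
allSubsets zero = [] ∷ []
allSubsets (suc m) = map (true ∷_) (allSubsets m) ++ map (false ∷_) (allSubsets m)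

record IsSimplicialComplex {m : ℕ} (Δ : Pred (Subset m) 0ℓ) : Set where
  field
    empty-face : Δ ⊥
    down-closed : ∀ {σ τ} → Δ σ → τ ⊆ σ → Δ τ

HasDim-1 : {m : ℕ} → Pred (Subset m) 0ℓ → ℕ → Set
HasDim-1 Δ d = (∃ λ σ → Δ σ × ∣ σ ∣ ≡ d) × (∀ σ → Δ σ → ∣ σ ∣ ≤ d)

IsBalancedColouring : {m d : ℕ} → Pred (Subset m) 0ℓ → (Fin m → Fin d) → Set
IsBalancedColouring Δ κ =
  ∀ σ → Δ σ → ∀ u v → u ∈ σ → v ∈ σ → κ u ≡ κ v → u ≡ v

-- f_{k-1}(Δ): number of faces with exactly k vertices.
faceCount : {m : ℕ} (Δ : Pred (Subset m) 0ℓ) → Decidable Δ → ℕ → ℕ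
faceCount {m} Δ Δ? k =
  length (filter (λ σ → Δ? σ ×-dec (∣ σ ∣ ℕ.≟ k)) (allSubsets m))

f₀ f₁ : {m : ℕ} (Δ : Pred (Subset m) 0ℓ) → Decidable Δ → ℕ
f₀ Δ Δ? = faceCount Δ Δ? 1
f₁ Δ Δ? = faceCount Δ Δ? 2

h₂ : {m : ℕ} (Δ : Pred (Subset m) 0ℓ) → Decidable Δ → ℕ → ℤ
h₂ Δ Δ? d =
  (+ (d C 2) ℤ.- ((+ d ℤ.- + 1) ℤ.* + f₀ Δ Δ?)) ℤ.+ + f₁ Δ Δ?

colourClassSize : {m d : ℕ} (Δ : Pred (Subset m) 0ℓ) → Decidable Δ →
                  (Fin m → Fin d) → Fin d → ℕ
colourClassSize {m} Δ Δ? κ i =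
  length (filter (λ v → Δ? ⁅ v ⁆ ×-dec (κ v Fin.≟ i)) (allFin m))

module Submission where

-- Let n = f₀ be the number of vertices.  The heart of the proof is the
-- counting inequality  f₁ + Σᵢ C(nᵢ,2) ≤ C(n,2):  an edge of Δ and a pair of
-- distinct vertices of the same colour are both pairs of vertices, and no
-- pair is both, since by balancedness the two ends of an edge have distinct
-- colours.  It is proved by induction on the ground set Fin m, deleting the
-- vertex 0: if {0} is a vertex, the new pairs are the edges at 0 and the
-- pairs joining 0 to its colour class, which again go to disjoint sets of
-- other vertices.  The theorem then follows by arithmetic: since a facet has
-- d vertices, d ≤ n, and writing n = d + k one has
--   C(d,2) − (d−1)n + C(n,2) = C(k+1,2),
-- so h₂ = C(k+1,2) − C(n,2) + f₁ ≤ C(k+1,2) − Σᵢ C(nᵢ,2).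

open import Defs
open import Level using (0ℓ; Level)
open import Data.Nat using (ℕ; zero; suc; _+_; _∸_; _*_; z≤n; s≤s)
import Data.Nat as ℕ
import Data.Nat.Properties as ℕP
open import Data.Nat.Combinatorics using (_C_; nC1≡n; nCk+nC[k+1]≡[n+1]C[k+1])
open import Data.Nat.ListAction using (sum)
open import Data.Nat.Tactic.RingSolver using (solve-∀)
open import Algebra.Properties.CommutativeSemigroup ℕP.+-commutativeSemigroup using (xy∙z≈xz∙y)
open import Data.Fin using (Fin; zero; suc)
import Data.Fin as Fin
open import Data.Fin.Properties using (suc-injective)
open import Data.Fin.Subset using (Subset; _∈_; _⊆_; ∣_∣; ⁅_⁆; ⊥)
open import Data.Fin.Subset.Properties using (x∈⁅x⁆; x∈⁅y⁆⇒x≡y; ∣⁅x⁆∣≡1)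
open import Data.Vec using (_∷_; []; here; there)
open import Data.List using (List; []; _∷_; _++_; map; filter; length; allFin)
open import Data.List.Properties
  using (filter-accept; filter-reject; filter-++; filter-≐; length-++; map-tabulate; map-∘; map-cong)
open import Data.Bool using (true; false)
open import Data.Product using (_×_; _,_; proj₁; proj₂)
open import Relation.Unary using (Pred; Decidable)
open import Relation.Nullary using (Dec; ¬_; yes; no; contradiction)
open import Relation.Nullary.Decidable using (_×-dec_)
open import Relation.Binary.PropositionalEquality
open import Function using (_∘_; id)
open import Data.Integer using (ℤ; +_; _-_; _≤_)
import Data.Integer as ℤ
import Data.Integer.Properties as ℤP
import Data.Integer.Tactic.RingSolver as ℤSolver

private variable
  a p q r : Level
  A B : Set a

count : {P : Pred A p} → Decidable P → List A → ℕ
count P? xs = length (filter P? xs)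

count-accept : {P : Pred A p} (P? : Decidable P) {x : A} {xs : List A} →
               P x → count P? (x ∷ xs) ≡ suc (count P? xs)
count-accept P? px = cong length (filter-accept P? px)

count-reject : {P : Pred A p} (P? : Decidable P) {x : A} {xs : List A} →
               ¬ P x → count P? (x ∷ xs) ≡ count P? xs
count-reject P? ¬px = cong length (filter-reject P? ¬px)

count-++ : {P : Pred A p} (P? : Decidable P) (xs ys : List A) →
           count P? (xs ++ ys) ≡ count P? xs + count P? ys
count-++ P? xs ys = trans (cong length (filter-++ P? xs ys)) (length-++ (filter P? xs))

count-map : {P : Pred A p} (P? : Decidable P) (f : B → A) (xs : List B) →
            count P? (map f xs) ≡ count (P? ∘ f) xs
count-map P? f [] = refl
count-map P? f (x ∷ xs) with P? (f x)
... | yes _ = cong suc (count-map P? f xs)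
... | no _  = count-map P? f xs

count-≐ : {P : Pred A p} {Q : Pred A q} (P? : Decidable P) (Q? : Decidable Q) →
          (∀ {x} → P x → Q x) → (∀ {x} → Q x → P x) → (xs : List A) → count P? xs ≡ count Q? xs
count-≐ P? Q? P⇒Q Q⇒P xs = cong length (filter-≐ P? Q? (P⇒Q , Q⇒P) xs)

count-none : {P : Pred A p} (P? : Decidable P) → (∀ x → ¬ P x) → (xs : List A) → count P? xs ≡ 0
count-none P? ¬P [] = refl
count-none P? ¬P (x ∷ xs) = trans (count-reject P? (¬P x)) (count-none P? ¬P xs)

count-disjoint : {P : Pred A p} {Q : Pred A q} {R : Pred A r}
                 (P? : Decidable P) (Q? : Decidable Q) (R? : Decidable R) →
                 (∀ {x} → P x → R x) → (∀ {x} → Q x → R x) → (∀ {x} → P x → ¬ Q x) →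
                 (xs : List A) → count P? xs + count Q? xs ℕ.≤ count R? xs
count-disjoint P? Q? R? P⇒R Q⇒R P⇒¬Q [] = z≤n
count-disjoint P? Q? R? P⇒R Q⇒R P⇒¬Q (x ∷ xs) with P? x | Q? x | R? x
... | yes px | yes qx | _      = contradiction qx (P⇒¬Q px)
... | yes px | no _   | no ¬rx = contradiction (P⇒R px) ¬rx
... | no _   | yes qx | no ¬rx = contradiction (Q⇒R qx) ¬rx
... | yes _  | no _   | yes _  = s≤s (count-disjoint P? Q? R? P⇒R Q⇒R P⇒¬Q xs)
... | no _   | yes _  | yes _  =
  subst (ℕ._≤ suc (count R? xs)) (sym (ℕP.+-suc (count P? xs) (count Q? xs)))
        (s≤s (count-disjoint P? Q? R? P⇒R Q⇒R P⇒¬Q xs))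
... | no _   | no _   | yes _  = ℕP.m≤n⇒m≤1+n (count-disjoint P? Q? R? P⇒R Q⇒R P⇒¬Q xs)
... | no _   | no _   | no _   = count-disjoint P? Q? R? P⇒R Q⇒R P⇒¬Q xs

allFin-suc : ∀ m → allFin (suc m) ≡ zero ∷ map suc (allFin m)
allFin-suc m = cong (zero ∷_) (sym (map-tabulate id suc))

count-allFin-suc : ∀ m {P : Pred (Fin (suc m)) p} (P? : Decidable P) →
                   count P? (allFin (suc m)) ≡ count P? (zero ∷ []) + count (P? ∘ suc) (allFin m)
count-allFin-suc m P? = begin
  count P? (allFin (suc m))                            ≡⟨ cong (count P?) (allFin-suc m) ⟩
  count P? ((zero ∷ []) ++ map suc (allFin m))         ≡⟨ count-++ P? (zero ∷ []) _ ⟩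
  count P? (zero ∷ []) + count P? (map suc (allFin m))
    ≡⟨ cong₂ _+_ (refl {x = count P? (zero ∷ [])}) (count-map P? suc (allFin m)) ⟩
  count P? (zero ∷ []) + count (P? ∘ suc) (allFin m)   ∎
  where open ≡-Reasoning

count-allSubsets-suc : ∀ m {P : Pred (Subset (suc m)) p} (P? : Decidable P) →
                       count P? (allSubsets (suc m)) ≡
                         count (P? ∘ (true ∷_)) (allSubsets m) + count (P? ∘ (false ∷_)) (allSubsets m)
count-allSubsets-suc m P? =
  trans (count-++ P? (map (true ∷_) (allSubsets m)) _)
        (cong₂ _+_ (count-map P? _ (allSubsets m)) (count-map P? _ (allSubsets m)))

count-emptySubsets : ∀ m {P : Pred (Subset m) p} (P? : Decidable P) →
                     (∀ σ → P σ → ∣ σ ∣ ≡ 0) → count P? (allSubsets m) ≡ count P? (⊥ ∷ [])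
count-emptySubsets zero    P? empty = refl
count-emptySubsets (suc m) P? empty = begin
  count P? (allSubsets (suc m))
    ≡⟨ count-allSubsets-suc m P? ⟩
  count (P? ∘ (true ∷_)) (allSubsets m) + count (P? ∘ (false ∷_)) (allSubsets m)
    ≡⟨ cong₂ _+_ (count-none (P? ∘ (true ∷_)) (λ τ Pτ → ℕP.1+n≢0 (empty _ Pτ)) (allSubsets m))
                 (count-emptySubsets m (P? ∘ (false ∷_)) (λ τ → empty _)) ⟩
  count (P? ∘ (false ∷_)) (⊥ ∷ [])
    ≡⟨ count-map P? (false ∷_) (⊥ ∷ []) ⟨
  count P? (⊥ ∷ []) ∎
  where open ≡-Reasoning

count-singletons : ∀ m {P : Pred (Subset m) p} (P? : Decidable P) →
                   (∀ σ → P σ → ∣ σ ∣ ≡ 1) → count P? (allSubsets m) ≡ count (P? ∘ ⁅_⁆) (allFin m)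
count-singletons zero    P? single = count-reject P? (λ P∅ → ℕP.0≢1+n (single [] P∅))
count-singletons (suc m) P? single = begin
  count P? (allSubsets (suc m))
    ≡⟨ count-allSubsets-suc m P? ⟩
  count (P? ∘ (true ∷_)) (allSubsets m) + count (P? ∘ (false ∷_)) (allSubsets m)
    ≡⟨ cong₂ _+_ (count-emptySubsets m (P? ∘ (true ∷_)) (λ τ → ℕP.suc-injective ∘ single _))
                 (count-singletons m (P? ∘ (false ∷_)) (λ τ → single _)) ⟩
  count (P? ∘ (true ∷_)) (⊥ ∷ []) + count (P? ∘ ⁅_⁆ ∘ suc) (allFin m)
    ≡⟨ cong (_+ count (P? ∘ ⁅_⁆ ∘ suc) (allFin m)) singletonZero ⟩
  count (P? ∘ ⁅_⁆) (zero ∷ []) + count (P? ∘ ⁅_⁆ ∘ suc) (allFin m)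
    ≡⟨ count-allFin-suc m (P? ∘ ⁅_⁆) ⟨
  count (P? ∘ ⁅_⁆) (allFin (suc m)) ∎
  where
  open ≡-Reasoning
  -- the only subset containing zero with one element is ⁅ zero ⁆ = true ∷ ⊥
  singletonZero : count (P? ∘ (true ∷_)) (⊥ ∷ []) ≡ count (P? ∘ ⁅_⁆) (zero ∷ [])
  singletonZero = trans (sym (count-map P? (true ∷_) (⊥ ∷ []))) (count-map P? ⁅_⁆ (zero ∷ []))

size≤count : ∀ m {Q : Pred (Fin m) p} (Q? : Decidable Q) (σ : Subset m) →
             (∀ {v} → v ∈ σ → Q v) → ∣ σ ∣ ℕ.≤ count Q? (allFin m)
size≤count zero    Q? []          inQ = z≤n
size≤count (suc m) Q? (true ∷ τ)  inQ = begin
  suc ∣ τ ∣                                            ≤⟨ s≤s (size≤count m (Q? ∘ suc) τ (inQ ∘ there)) ⟩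
  suc (count (Q? ∘ suc) (allFin m))
    ≡⟨ cong (_+ count (Q? ∘ suc) (allFin m)) (count-accept Q? (inQ here)) ⟨
  count Q? (zero ∷ []) + count (Q? ∘ suc) (allFin m)   ≡⟨ count-allFin-suc m Q? ⟨
  count Q? (allFin (suc m))                            ∎
  where open ℕP.≤-Reasoning
size≤count (suc m) Q? (false ∷ τ) inQ = begin
  ∣ τ ∣                                                ≤⟨ size≤count m (Q? ∘ suc) τ (inQ ∘ there) ⟩
  count (Q? ∘ suc) (allFin m)                          ≤⟨ ℕP.m≤n+m _ (count Q? (zero ∷ [])) ⟩
  count Q? (zero ∷ []) + count (Q? ∘ suc) (allFin m)   ≡⟨ count-allFin-suc m Q? ⟨
  count Q? (allFin (suc m))                            ∎
  where open ℕP.≤-Reasoning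

sumFin : ∀ {d} → (Fin d → ℕ) → ℕ
sumFin {d} f = sum (map f (allFin d))

sumFin-suc : ∀ {d} (f : Fin (suc d) → ℕ) → sumFin f ≡ f zero + sumFin (f ∘ suc)
sumFin-suc {d} f = begin
  sum (map f (allFin (suc d)))             ≡⟨ cong (sum ∘ map f) (allFin-suc d) ⟩
  f zero + sum (map f (map suc (allFin d))) ≡⟨ cong (λ xs → f zero + sum xs) (map-∘ (allFin d)) ⟨
  f zero + sum (map (f ∘ suc) (allFin d))   ∎
  where open ≡-Reasoning

sumFin-cong : ∀ {d} {f g : Fin d → ℕ} → (∀ i → f i ≡ g i) → sumFin f ≡ sumFin g
sumFin-cong {d} f≗g = cong sum (map-cong f≗g (allFin d))

sumFin-zero : ∀ d → sumFin {d} (λ _ → 0) ≡ 0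
sumFin-zero zero    = refl
sumFin-zero (suc d) = trans (sumFin-suc {d} (λ _ → 0)) (sumFin-zero d)

sumFin-update : ∀ {d} (f f′ : Fin d → ℕ) (c : Fin d) (δ : ℕ) →
                f′ c ≡ f c + δ → (∀ i → c ≢ i → f′ i ≡ f i) → sumFin f′ ≡ sumFin f + δ
sumFin-update f f′ zero δ at-c elsewhere = begin
  sumFin f′                        ≡⟨ sumFin-suc f′ ⟩
  f′ zero + sumFin (f′ ∘ suc)      ≡⟨ cong₂ _+_ at-c (sumFin-cong (λ i → elsewhere (suc i) (λ ()))) ⟩
  f zero + δ + sumFin (f ∘ suc)    ≡⟨ xy∙z≈xz∙y (f zero) δ _ ⟩
  f zero + sumFin (f ∘ suc) + δ    ≡⟨ cong (_+ δ) (sumFin-suc f) ⟨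
  sumFin f + δ                     ∎
  where open ≡-Reasoning
sumFin-update f f′ (suc c) δ at-c elsewhere = begin
  sumFin f′                        ≡⟨ sumFin-suc f′ ⟩
  f′ zero + sumFin (f′ ∘ suc)      ≡⟨ cong₂ _+_ (elsewhere zero (λ ())) (sumFin-update (f ∘ suc) (f′ ∘ suc) c δ at-c
                                                   (λ i c≢i → elsewhere (suc i) (c≢i ∘ suc-injective))) ⟩
  f zero + (sumFin (f ∘ suc) + δ)  ≡⟨ ℕP.+-assoc (f zero) _ δ ⟨
  f zero + sumFin (f ∘ suc) + δ    ≡⟨ cong (_+ δ) (sumFin-suc f) ⟨
  sumFin f + δ                     ∎
  where open ≡-Reasoning

C2-suc : ∀ x → suc x C 2 ≡ x C 2 + x
C2-suc x = begin
  suc x C 2        ≡⟨ nCk+nC[k+1]≡[n+1]C[k+1] x 1 ⟨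
  x C 1 + x C 2    ≡⟨ cong (_+ x C 2) (nC1≡n x) ⟩
  x + x C 2        ≡⟨ ℕP.+-comm x (x C 2) ⟩
  x C 2 + x        ∎
  where open ≡-Reasoning

-- With n = d + k:  C(d,2) + C(n,2) + n = C(k+1,2) + d·n.  This is the identity
-- C(d,2) − (d−1)n + C(n,2) = C(n−d+1,2) behind the final arithmetic.
pairs-identity : ∀ d k → d C 2 + (d + k) C 2 + (d + k) ≡ suc k C 2 + d * (d + k)
pairs-identity zero    k = trans (sym (C2-suc k)) (sym (ℕP.+-identityʳ (suc k C 2)))
pairs-identity (suc d) k = begin
  suc d C 2 + suc (d + k) C 2 + suc (d + k)
    ≡⟨ cong₂ (λ x y → x + y + suc (d + k)) (C2-suc d) (C2-suc (d + k)) ⟩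
  (d C 2 + d) + ((d + k) C 2 + (d + k)) + suc (d + k)
    ≡⟨ regroup (d C 2) ((d + k) C 2) d k ⟩
  (d C 2 + (d + k) C 2 + (d + k)) + (d + suc (d + k))
    ≡⟨ cong (_+ (d + suc (d + k))) (pairs-identity d k) ⟩
  (suc k C 2 + d * (d + k)) + (d + suc (d + k))
    ≡⟨ expand (suc k C 2) d k ⟩
  suc k C 2 + suc d * suc (d + k) ∎
  where
  open ≡-Reasoning
  regroup : ∀ a b d k → (a + d) + (b + (d + k)) + suc (d + k) ≡ (a + b + (d + k)) + (d + suc (d + k))
  regroup = solve-∀
  expand : ∀ c d k → (c + d * (d + k)) + (d + suc (d + k)) ≡ c + suc d * suc (d + k)
  expand = solve-∀

vertexCount : ∀ {m} {P : Pred (Subset m) 0ℓ} → Decidable P → ℕ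
vertexCount {m} P? = count (P? ∘ ⁅_⁆) (allFin m)

monochromaticPairs : ∀ {m d} (P : Pred (Subset m) 0ℓ) → Decidable P → (Fin m → Fin d) → ℕ
monochromaticPairs P P? κ = sumFin (λ i → colourClassSize P P? κ i C 2)

VertexClosed : ∀ {m} → Pred (Subset m) 0ℓ → Set
VertexClosed P = ∀ {σ u} → P σ → u ∈ σ → P ⁅ u ⁆

isEdge? : ∀ {m} {P : Pred (Subset m) 0ℓ} → Decidable P → Decidable (λ σ → P σ × ∣ σ ∣ ≡ 2)
isEdge? P? σ = P? σ ×-dec (∣ σ ∣ ℕ.≟ 2)

edgesAtZero : ∀ {m} {P : Pred (Subset (suc m)) 0ℓ} → Decidable P → ℕ
edgesAtZero {m} P? = count (isEdge? P? ∘ (true ∷_) ∘ ⁅_⁆) (allFin m)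

vertexClosed-avoidZero : ∀ {m} {P : Pred (Subset (suc m)) 0ℓ} →
                         VertexClosed P → VertexClosed (P ∘ (false ∷_))
vertexClosed-avoidZero closed Pτ u∈τ = closed Pτ (there u∈τ)

balanced-avoidZero : ∀ {m d} {P : Pred (Subset (suc m)) 0ℓ} {κ : Fin (suc m) → Fin d} →
                     IsBalancedColouring P κ → IsBalancedColouring (P ∘ (false ∷_)) (κ ∘ suc)
balanced-avoidZero balanced τ Pτ u v u∈τ v∈τ same =
  suc-injective (balanced _ Pτ (suc u) (suc v) (there u∈τ) (there v∈τ) same)

f₁-suc : ∀ m {P : Pred (Subset (suc m)) 0ℓ} (P? : Decidable P) →
         f₁ P P? ≡ edgesAtZero P? + f₁ (P ∘ (false ∷_)) (P? ∘ (false ∷_))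
f₁-suc m P? =
  trans (count-allSubsets-suc m (isEdge? P?))
        (cong (_+ f₁ _ (P? ∘ (false ∷_)))
              (count-singletons m (isEdge? P? ∘ (true ∷_)) (λ τ → ℕP.suc-injective ∘ proj₂)))

edgesAtZero-nonvertex : ∀ m {P : Pred (Subset (suc m)) 0ℓ} (P? : Decidable P) →
                        VertexClosed P → ¬ P ⁅ zero ⁆ → edgesAtZero P? ≡ 0
edgesAtZero-nonvertex m P? closed ¬P₀ =
  count-none (isEdge? P? ∘ (true ∷_) ∘ ⁅_⁆) (λ v edge → ¬P₀ (closed (proj₁ edge) here)) (allFin m)

-- The neighbours of zero and the other vertices of zero's colour are disjoint
-- sets of vertices avoiding zero: a neighbour has a different colour.
edgesAtZero+colourClass≤vertices :
  ∀ m {d} {P : Pred (Subset (suc m)) 0ℓ} (P? : Decidable P) (κ : Fin (suc m) → Fin d) →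
  VertexClosed P → IsBalancedColouring P κ →
  edgesAtZero P? + colourClassSize (P ∘ (false ∷_)) (P? ∘ (false ∷_)) (κ ∘ suc) (κ zero)
    ℕ.≤ vertexCount (P? ∘ (false ∷_))
edgesAtZero+colourClass≤vertices m P? κ closed balanced =
  count-disjoint _ _ _ (λ {v} edge → closed (proj₁ edge) (there (x∈⁅x⁆ v))) proj₁
    (λ {v} edge same → zero≢suc (balanced _ (proj₁ edge) zero (suc v) here (there (x∈⁅x⁆ v)) (sym (proj₂ same))))
    (allFin m)
  where
  zero≢suc : ∀ {v : Fin m} → ¬ (zero ≡ Fin.suc v)
  zero≢suc ()

colourClassSize-suc : ∀ m {d} {P : Pred (Subset (suc m)) 0ℓ} (P? : Decidable P)
                      (κ : Fin (suc m) → Fin d) (i : Fin d) →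
                      colourClassSize P P? κ i ≡
                        count (λ v → P? ⁅ v ⁆ ×-dec (κ v Fin.≟ i)) (zero ∷ []) +
                        colourClassSize (P ∘ (false ∷_)) (P? ∘ (false ∷_)) (κ ∘ suc) i
colourClassSize-suc m P? κ i = count-allFin-suc m (λ v → P? ⁅ v ⁆ ×-dec (κ v Fin.≟ i))

-- If zero is a vertex, its colour class grows by one, so the monochromatic
-- pairs gain the pairs joining zero to the rest of its class.
monochromaticPairs-vertex :
  ∀ m {d} {P : Pred (Subset (suc m)) 0ℓ} (P? : Decidable P) (κ : Fin (suc m) → Fin d) →
  P ⁅ zero ⁆ →
  monochromaticPairs P P? κ ≡
    monochromaticPairs (P ∘ (false ∷_)) (P? ∘ (false ∷_)) (κ ∘ suc) +
    colourClassSize (P ∘ (false ∷_)) (P? ∘ (false ∷_)) (κ ∘ suc) (κ zero)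
monochromaticPairs-vertex m {d} {P = P} P? κ P₀ =
  sumFin-update (λ i → class′ i C 2) (λ i → colourClassSize P P? κ i C 2) (κ zero) (class′ (κ zero))
    (trans (cong (_C 2) (trans (colourClassSize-suc m P? κ (κ zero))
                               (cong (_+ class′ (κ zero)) (count-accept (vertexOfColour? (κ zero)) (P₀ , refl)))))
           (C2-suc (class′ (κ zero))))
    (λ i κ₀≢i → cong (_C 2) (trans (colourClassSize-suc m P? κ i)
                                   (cong (_+ class′ i) (count-reject (vertexOfColour? i) (κ₀≢i ∘ proj₂)))))
  where
  class′ : Fin d → ℕ
  class′ = colourClassSize (P ∘ (false ∷_)) (P? ∘ (false ∷_)) (κ ∘ suc)
  vertexOfColour? : ∀ i → Decidable (λ v → P ⁅ v ⁆ × κ v ≡ i)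
  vertexOfColour? i v = P? ⁅ v ⁆ ×-dec (κ v Fin.≟ i)

monochromaticPairs-nonvertex :
  ∀ m {d} {P : Pred (Subset (suc m)) 0ℓ} (P? : Decidable P) (κ : Fin (suc m) → Fin d) →
  ¬ P ⁅ zero ⁆ →
  monochromaticPairs P P? κ ≡ monochromaticPairs (P ∘ (false ∷_)) (P? ∘ (false ∷_)) (κ ∘ suc)
monochromaticPairs-nonvertex m {d} {P = P} P? κ ¬P₀ = sumFin-cong λ i →
  cong (_C 2) (trans (colourClassSize-suc m P? κ i)
                     (cong (_+ class′ i) (count-reject (vertexOfColour? i) (¬P₀ ∘ proj₁))))
  where
  class′ : Fin d → ℕ
  class′ = colourClassSize (P ∘ (false ∷_)) (P? ∘ (false ∷_)) (κ ∘ suc)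
  vertexOfColour? : ∀ i → Decidable (λ v → P ⁅ v ⁆ × κ v ≡ i)
  vertexOfColour? i v = P? ⁅ v ⁆ ×-dec (κ v Fin.≟ i)

edges+monochromaticPairs≤pairs :
  ∀ m {d} {P : Pred (Subset m) 0ℓ} (P? : Decidable P) (κ : Fin m → Fin d) →
  VertexClosed P → IsBalancedColouring P κ →
  f₁ P P? + monochromaticPairs P P? κ ℕ.≤ vertexCount P? C 2
edges+monochromaticPairs≤pairs zero {d} P? κ closed balanced =
  ℕP.≤-reflexive (cong₂ _+_ (count-reject (isEdge? P?) λ { (_ , ()) }) (sumFin-zero d))
edges+monochromaticPairs≤pairs (suc m) {d} {P = P} P? κ closed balanced = byVertexZero (P? ⁅ zero ⁆)
  where
  open ℕP.≤-Reasoning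
  P′? : Decidable (P ∘ (false ∷_))
  P′? = P? ∘ (false ∷_)
  κ′ : Fin m → Fin d
  κ′ = κ ∘ suc
  f₁′ pairs′ n′ e c zeroIsVertex : ℕ
  f₁′ = f₁ (P ∘ (false ∷_)) P′?
  pairs′ = monochromaticPairs (P ∘ (false ∷_)) P′? κ′
  n′ = vertexCount P′?
  e = edgesAtZero P?
  c = colourClassSize (P ∘ (false ∷_)) P′? κ′ (κ zero)
  zeroIsVertex = count (P? ∘ ⁅_⁆) (zero ∷ [])

  induction : f₁′ + pairs′ ℕ.≤ n′ C 2
  induction = edges+monochromaticPairs≤pairs m P′? κ′
                (vertexClosed-avoidZero closed) (balanced-avoidZero {κ = κ} balanced)

  byVertexZero : Dec (P ⁅ zero ⁆) → f₁ P P? + monochromaticPairs P P? κ ℕ.≤ vertexCount P? C 2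
  byVertexZero (yes P₀) = begin
    f₁ P P? + monochromaticPairs P P? κ
      ≡⟨ cong₂ _+_ (f₁-suc m P?) (monochromaticPairs-vertex m P? κ P₀) ⟩
    (e + f₁′) + (pairs′ + c)       ≡⟨ regroup e f₁′ pairs′ c ⟩
    (f₁′ + pairs′) + (e + c)       ≤⟨ ℕP.+-mono-≤ induction (edgesAtZero+colourClass≤vertices m P? κ closed balanced) ⟩
    n′ C 2 + n′                    ≡⟨ C2-suc n′ ⟨
    suc n′ C 2                     ≡⟨ cong (λ z → (z + n′) C 2) (count-accept (P? ∘ ⁅_⁆) P₀) ⟨
    (zeroIsVertex + n′) C 2        ≡⟨ cong (_C 2) (count-allFin-suc m (P? ∘ ⁅_⁆)) ⟨
    vertexCount P? C 2             ∎
    where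
    regroup : ∀ e f s c → (e + f) + (s + c) ≡ (f + s) + (e + c)
    regroup = solve-∀
  byVertexZero (no ¬P₀) = begin
    f₁ P P? + monochromaticPairs P P? κ
      ≡⟨ cong₂ _+_ (trans (f₁-suc m P?) (cong (_+ f₁′) (edgesAtZero-nonvertex m P? closed ¬P₀)))
                   (monochromaticPairs-nonvertex m P? κ ¬P₀) ⟩
    f₁′ + pairs′                   ≤⟨ induction ⟩
    n′ C 2                         ≡⟨ cong (λ z → (z + n′) C 2) (count-reject (P? ∘ ⁅_⁆) ¬P₀) ⟨
    (zeroIsVertex + n′) C 2        ≡⟨ cong (_C 2) (count-allFin-suc m (P? ∘ ⁅_⁆)) ⟨
    vertexCount P? C 2             ∎

h₂-pairs-identity : ∀ {d n} → d ℕ.≤ n →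
                    (+ (d C 2) - (+ d - + 1) ℤ.* + n) ℤ.+ + (n C 2) ≡ + ((n ∸ d + 1) C 2)
h₂-pairs-identity {d} {n} d≤n = begin
  (+ (d C 2) - (+ d - + 1) ℤ.* + n) ℤ.+ + (n C 2)   ≡⟨ expand (+ (d C 2)) (+ (n C 2)) (+ d) (+ n) ⟩
  (+ (d C 2) ℤ.+ + (n C 2) ℤ.+ + n) - + d ℤ.* + n   ≡⟨ cong₂ _-_ sum-pos (ℤP.pos-* d n) ⟨
  + (d C 2 + n C 2 + n) - + (d * n)                 ≡⟨ cong (λ z → + z - + (d * n)) identity ⟩
  + (suc k C 2 + d * n) - + (d * n)                 ≡⟨ cong (_- + (d * n)) (ℤP.pos-+ (suc k C 2) (d * n)) ⟩
  (+ (suc k C 2) ℤ.+ + (d * n)) - + (d * n)         ≡⟨ cancel (+ (suc k C 2)) (+ (d * n)) ⟩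
  + (suc k C 2)                                     ≡⟨ cong (λ z → + (z C 2)) (ℕP.+-comm 1 k) ⟩
  + ((k + 1) C 2)                                   ∎
  where
  open ≡-Reasoning
  k : ℕ
  k = n ∸ d
  identity : d C 2 + n C 2 + n ≡ suc k C 2 + d * n
  identity = subst (λ n → d C 2 + n C 2 + n ≡ suc k C 2 + d * n) (ℕP.m+[n∸m]≡n d≤n) (pairs-identity d k)
  sum-pos : + (d C 2 + n C 2 + n) ≡ + (d C 2) ℤ.+ + (n C 2) ℤ.+ + n
  sum-pos = trans (ℤP.pos-+ (d C 2 + n C 2) n) (cong (ℤ._+ + n) (ℤP.pos-+ (d C 2) (n C 2)))
  expand : ∀ x y d n → (x - (d - + 1) ℤ.* n) ℤ.+ y ≡ (x ℤ.+ y ℤ.+ n) - d ℤ.* n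
  expand = ℤSolver.solve-∀
  cancel : ∀ x y → (x ℤ.+ y) - y ≡ x
  cancel = ℤSolver.solve-∀

shift-≤ : (X : ℤ) (f S N : ℕ) → f + S ℕ.≤ N → X ℤ.+ + f ≤ (X ℤ.+ + N) - + S
shift-≤ X f S N f+S≤N = begin
  X ℤ.+ + f                         ≡⟨ regroup X (+ f) (+ S) ⟩
  (X ℤ.+ (+ f ℤ.+ + S)) - + S       ≡⟨ cong (λ z → (X ℤ.+ z) - + S) (ℤP.pos-+ f S) ⟨
  (X ℤ.+ + (f + S)) - + S           ≤⟨ ℤP.+-monoˡ-≤ (ℤ.- + S) (ℤP.+-monoʳ-≤ X (ℤ.+≤+ f+S≤N)) ⟩
  (X ℤ.+ + N) - + S                 ∎
  where
  open ℤP.≤-Reasoning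
  regroup : ∀ x f s → x ℤ.+ f ≡ (x ℤ.+ (f ℤ.+ s)) - s
  regroup = ℤSolver.solve-∀

h₂-arithmetic : ∀ d n f S → d ℕ.≤ n → f + S ℕ.≤ n C 2 →
                (+ (d C 2) - (+ d - + 1) ℤ.* + n) ℤ.+ + f ≤ + ((n ∸ d + 1) C 2) - + S
h₂-arithmetic d n f S d≤n f+S≤pairs =
  subst (λ t → (+ (d C 2) - (+ d - + 1) ℤ.* + n) ℤ.+ + f ≤ t - + S) (h₂-pairs-identity d≤n)
        (shift-≤ (+ (d C 2) - (+ d - + 1) ℤ.* + n) f S (n C 2) f+S≤pairs)

simplicialComplex-vertexClosed : ∀ {m} {Δ : Pred (Subset m) 0ℓ} → IsSimplicialComplex Δ → VertexClosed Δ
simplicialComplex-vertexClosed complex {σ} {u} Δσ u∈σ = IsSimplicialComplex.down-closed complex Δσ ⁅u⁆⊆σ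
  where
  ⁅u⁆⊆σ : ⁅ u ⁆ ⊆ σ
  ⁅u⁆⊆σ v∈⁅u⁆ = subst (_∈ σ) (sym (x∈⁅y⁆⇒x≡y u v∈⁅u⁆)) u∈σ

f₀≡vertexCount : ∀ m {P : Pred (Subset m) 0ℓ} (P? : Decidable P) → f₀ P P? ≡ vertexCount P?
f₀≡vertexCount m P? =
  trans (count-singletons m (λ σ → P? σ ×-dec (∣ σ ∣ ℕ.≟ 1)) (λ σ → proj₂))
        (count-≐ _ _ proj₁ (λ {v} Pv → Pv , ∣⁅x⁆∣≡1 v) (allFin m))

lemma4p6 : (m d : ℕ) (Δ : Pred (Subset m) 0ℓ) (Δ? : Decidable Δ)
           (κ : Fin m → Fin d) →
           IsSimplicialComplex Δ → HasDim-1 Δ d → IsBalancedColouring Δ κ →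
           h₂ Δ Δ? d ≤
             (+ (((f₀ Δ Δ? ∸ d) + 1) C 2)
               - + sum (map (λ i → colourClassSize Δ Δ? κ i C 2) (allFin d)))
lemma4p6 m d Δ Δ? κ complex ((facet , Δfacet , ∣facet∣≡d) , _) balanced =
  h₂-arithmetic d (f₀ Δ Δ?) (f₁ Δ Δ?) (monochromaticPairs Δ Δ? κ) d≤f₀ edges+pairs≤
  where
  closed : VertexClosed Δ
  closed = simplicialComplex-vertexClosed complex
  -- a facet has d elements, all of them vertices
  d≤f₀ : d ℕ.≤ f₀ Δ Δ?
  d≤f₀ = subst₂ ℕ._≤_ ∣facet∣≡d (sym (f₀≡vertexCount m Δ?))
                (size≤count m (Δ? ∘ ⁅_⁆) facet (closed Δfacet))
  edges+pairs≤ : f₁ Δ Δ? + monochromaticPairs Δ Δ? κ ℕ.≤ f₀ Δ Δ? C 2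
  edges+pairs≤ = subst (λ n → f₁ Δ Δ? + monochromaticPairs Δ Δ? κ ℕ.≤ n C 2) (sym (f₀≡vertexCount m Δ?))
                       (edges+monochromaticPairs≤pairs m Δ? κ closed balanced)
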